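{- Let $\phi$ be a rank $r$ Drinfeld module $\mathbb{F}_q[T]\to\mathrm{End}_{\mathbb{F}_q(T)}(\mathbb{G}_a)$ with $\phi_T(x)=Tx+c_1x^q+\dots+c_rx^{q^r}$, where $c_1,\dots,c_r\in\mathbb{F}_q[T]$ and $c_r\neq0$. Then for all $x\in\mathbb{F}_q[T]$, $$h(x)-\hat h(x)\le M_\phi,\qquad M_\phi=\frac{q}{(\Theta-1)(q-1)}\max\{1-\deg c_r,\ \deg c_1-\deg c_r,\dots,\deg c_{r-1}-\deg c_r,\ 0\}.$$
   Context: $\Theta=q^r$. $\phi_{T^n}$ is the $n$-fold iterate of $\phi_T$. Places of $\mathbb{F}_q(T)$: finite places $v$ correspond to monic irreducible $P$, with $|y|_v=q^{ -\deg P\cdot\mathrm{ord}_P(y)}$; the infinite place has $|y|_{v_\infty}=q^{\deg y}$. Height: $h(y)=\sum_v\log_q\max\{|y|_v,1\}$ (equal to $\max\{\deg a,\deg b\}$ for $y=a/b$ in lowest terms). Canonical height: $\hat h(x)=\lim_{n\to\infty}h(\phi_{T^n}(x))/\Theta^n$. -}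

module Defs where

open import Level using (Level)
open import Data.Nat as ℕ using (ℕ; zero; suc; _^_; _∸_; _≤_; NonZero)
open import Data.Nat.Properties as ℕP using ()
open import Data.Fin using (Fin)
open import Data.List using (List; []; _∷_; length; map; foldr)
open import Data.Vec as Vec using (Vec; []; _∷_; last; init)
open import Data.Product using (∃; _,_)
open import Data.Empty using (⊥-elim)
open import Data.Integer as ℤ using (ℤ; +_)
open import Data.Rational.Unnormalised as ℚ using (ℚᵘ)
open import Relation.Nullary using (¬_; yes; no)
open import Relation.Binary.PropositionalEquality using (_≡_; _≢_; refl; cong; sym; trans)
open import Relation.Binary.Definitions using (DecidableEquality)
open import Algebra.Structures using (IsCommutativeRing)
open import Function.Bundles using (_↔_; Inverse)

record FiniteField (c : Level) : Set (Level.suc c) where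
  field
    Carrier : Set c
    _+_ _*_ : Carrier → Carrier → Carrier
    -_      : Carrier → Carrier
    0# 1#   : Carrier
    isCommutativeRing : IsCommutativeRing _≡_ _+_ _*_ -_ 0# 1#
    _≟_     : DecidableEquality Carrier
    0≢1     : 0# ≢ 1#
    inverse : ∀ x → x ≢ 0# → ∃ λ y → x * y ≡ 1#
    q       : ℕ
    enum    : Carrier ↔ Fin q

module Drinfeld {c : Level} (F : FiniteField c) where
  open FiniteField F

  private
    q≢0 : q ≢ 0
    q≢0 eq with Inverse.to enum 0#
    ... | i rewrite eq with i
    ... | ()

    q≢1 : q ≢ 1
    q≢1 eq = 0≢1 (trans (sym (Inverse.strictlyInverseʳ enum 0#))
                 (trans (cong (Inverse.from enum) (lem (Inverse.to enum 0#) (Inverse.to enum 1#)))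
                        (Inverse.strictlyInverseʳ enum 1#)))
      where
        lem : (i j : Fin q) → i ≡ j
        lem i j rewrite eq with i | j
        ... | Fin.zero | Fin.zero = refl

  -- Polynomials in 𝔽_q[T]: coefficient lists, lowest degree first
  -- (trailing zero coefficients allowed; see `strip`).
  Poly : Set c
  Poly = List Carrier

  addP : Poly → Poly → Poly
  addP [] ys = ys
  addP (x ∷ xs) [] = x ∷ xs
  addP (x ∷ xs) (y ∷ ys) = (x + y) ∷ addP xs ys

  scaleP : Carrier → Poly → Poly
  scaleP a = map (a *_)

  mulP : Poly → Poly → Poly
  mulP [] ys = []
  mulP (x ∷ xs) ys = addP (scaleP x ys) (0# ∷ mulP xs ys)

  powP : Poly → ℕ → Poly
  powP p zero = 1# ∷ []
  powP p (suc n) = mulP p (powP p n)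

  TP : Poly
  TP = 0# ∷ 1# ∷ []

  strip : Poly → Poly
  strip [] = []
  strip (x ∷ xs) with strip xs
  ... | y ∷ ys = x ∷ y ∷ ys
  ... | [] with x ≟ 0#
  ...   | yes _ = []
  ...   | no  _ = x ∷ []

  IsZeroP : Poly → Set c
  IsZeroP p = strip p ≡ []

  -- degree of a nonzero polynomial (the value 0 is returned for the zero polynomial)
  deg : Poly → ℕ
  deg p = length (strip p) ∸ 1

  -- Weil height on 𝔽_q[T] ⊂ 𝔽_q(T): h(x) = deg x for x ≠ 0, h(0) = 0
  -- (this is max{deg a, deg b} for x = a/1, and log_q max{|0|,1} summed = 0 for x = 0).
  h : Poly → ℕ
  h = deg

  higherTerms : ∀ {k} → ℕ → Vec Poly k → Poly → Poly
  higherTerms j [] x = []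
  higherTerms j (cᵢ ∷ cs) x = addP (mulP cᵢ (powP x (q ^ j))) (higherTerms (suc j) cs x)

  -- φ_T(x) = T x + c₁ x^q + … + c_r x^{q^r}, with cs = (c₁, …, c_r), r = suc k
  φT : ∀ {k} → Vec Poly (suc k) → Poly → Poly
  φT cs x = addP (mulP TP x) (higherTerms 1 cs x)

  φTⁿ : ∀ {k} → Vec Poly (suc k) → ℕ → Poly → Poly
  φTⁿ cs zero x = x
  φTⁿ cs (suc n) x = φT cs (φTⁿ cs n x)

  Θ : ℕ → ℕ
  Θ r = q ^ r

  private
    instance
      q-nz : NonZero q
      q-nz = ℕ.≢-nonZero q≢0

    Θⁿ-nz : ∀ r n → NonZero (Θ r ^ n)
    Θⁿ-nz r n = ℕP.m^n≢0 (Θ r) n {{ℕP.m^n≢0 q r}}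

    q^suc≥2 : ∀ k → 2 ≤ q ^ suc k
    q^suc≥2 k = ℕP.≤-trans q≥2 (ℕP.m≤m*n q (q ^ k) {{ℕP.m^n≢0 q k}})
      where
        q≥2 : 2 ≤ q
        q≥2 with q | q≢0 | q≢1
        ... | zero | ne | _ = ⊥-elim (ne refl)
        ... | suc zero | _ | ne = ⊥-elim (ne refl)
        ... | suc (suc _) | _ | _ = ℕ.s≤s (ℕ.s≤s ℕ.z≤n)

    den-nz : ∀ k → NonZero ((Θ (suc k) ∸ 1) ℕ.* (q ∸ 1))
    den-nz k = ℕ.≢-nonZero λ eq → ⊥-elim (ℕP.m*n≢0 (Θ (suc k) ∸ 1) (q ∸ 1)
                  {{pos (q^suc≥2 k)}} {{pos (ℕP.≤-trans (ℕ.s≤s (ℕ.s≤s ℕ.z≤n)) (ℕP.≤-trans (q^suc≥2 zero) (ℕP.≤-reflexive (ℕP.*-identityʳ q))))}} |> λ nz → ℕ.≢-nonZero⁻¹ _ {{nz}} eq)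
      where
        pos : ∀ {m} → 2 ≤ m → NonZero (m ∸ 1)
        pos (ℕ.s≤s (ℕ.s≤s _)) = _
        _|>_ : ∀ {a b} {A : Set a} {B : Set b} → A → (A → B) → B
        x |> f = f x

  -- h(φ_{T^n}(x)) / Θ^n  (the n-th approximation of the canonical height)
  ĥApprox : ∀ {k} → Vec Poly (suc k) → Poly → ℕ → ℚᵘ
  ĥApprox {k} cs x n = ℚ._/_ (+ h (φTⁿ cs n x)) (Θ (suc k) ^ n) {{Θⁿ-nz (suc k) n}}

  -- the terms deg c_i − deg c_r for 1 ≤ i ≤ r−1 and c_i ≠ 0
  -- (for c_i = 0, deg c_i = −∞ and the term does not contribute to the max)
  degDiffs : ∀ {m} → ℕ → Vec Poly m → List ℤ
  degDiffs dr [] = []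
  degDiffs dr (cᵢ ∷ cs) with strip cᵢ
  ... | [] = degDiffs dr cs
  ... | _ ∷ _ = (+ deg cᵢ ℤ.- + dr) ∷ degDiffs dr cs

  maxTerm : ∀ {k} → Vec Poly (suc k) → ℤ
  maxTerm cs = foldr ℤ._⊔_ (+ 0)
    ((+ 1 ℤ.- + deg (last cs)) ∷ degDiffs (deg (last cs)) (init cs))

  Mφ : ∀ {k} → Vec Poly (suc k) → ℚᵘ
  Mφ {k} cs = ℚ._/_ (+ q ℤ.* maxTerm cs) ((Θ (suc k) ∸ 1) ℕ.* (q ∸ 1)) {{den-nz k}}

{-# OPTIONS --safe #-}
module Submission where

-- Write m for the nonnegative integer with M_φ = q m / ((Θ - 1)(q - 1)), so that
-- deg c_r + m ≥ 1 and deg c_r + m ≥ deg c_i for i < r.  If m < q^(r-1) (q - 1) deg y,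
-- the leading term c_r y^Θ of φ_T(y) has degree strictly larger than those of T y and
-- of every c_i y^(q^i), so deg φ_T(y) = deg c_r + Θ deg y ≥ Θ deg y; since the degree
-- only grows, iterating gives h(φ_{T^n}(x)) ≥ Θ^n h(x), i.e. h(x) is below every
-- approximation of ĥ(x).  Otherwise h(x) ≤ M_φ, and the approximations are nonnegative.

open import Defs

module NatInequalities where

  open import Data.Nat using (suc; _+_; _*_; _^_; _∸_; _≤_; _<_; NonZero)
  open import Data.Nat.Properties
  open import Data.Nat.Solver using (module +-*-Solver)
  open import Relation.Binary.PropositionalEquality using (_≡_; refl; cong)
  open +-*-Solver using (solve; _:+_; _:*_; _:=_; con)
  open ≤-Reasoning

  lower-terms-below-top : ∀ q .{{_ : NonZero q}} k A b e {i} → i ≤ k →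
    A < q ^ k * (q ∸ 1) * e → (b + A) + q ^ i * e < b + q ^ suc k * e
  lower-terms-below-top q@(suc q′) k A b e {i} i≤k A<gap = begin-strict
    (b + A) + q ^ i * e                    ≤⟨ +-monoʳ-≤ (b + A) (*-monoˡ-≤ e (^-monoʳ-≤ q i≤k)) ⟩
    (b + A) + q ^ k * e                    ≡⟨ +-assoc b A _ ⟩
    b + (A + q ^ k * e)                    <⟨ +-monoʳ-< b (+-monoˡ-< (q ^ k * e) A<gap) ⟩
    b + (q ^ k * q′ * e + q ^ k * e)       ≡⟨ cong (b +_) (gap-identity (q ^ k) q′ e) ⟩
    b + q ^ suc k * e                      ∎
    where
      gap-identity : ∀ K q′ e → K * q′ * e + K * e ≡ suc q′ * K * e
      gap-identity = solve 3 (λ K q′ e → K :* q′ :* e :+ K :* e := (con 1 :+ q′) :* K :* e) refl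

  above-threshold : ∀ q .{{_ : NonZero q}} k A e →
    q * A < e * ((q ^ suc k ∸ 1) * (q ∸ 1)) → A < q ^ k * (q ∸ 1) * e
  above-threshold q k A e qA<e·den = *-cancelˡ-< q A _ (begin-strict
    q * A                               <⟨ qA<e·den ⟩
    e * ((q ^ suc k ∸ 1) * (q ∸ 1))     ≤⟨ *-monoʳ-≤ e (*-monoˡ-≤ (q ∸ 1) (m∸n≤m (q ^ suc k) 1)) ⟩
    e * (q * q ^ k * (q ∸ 1))           ≡⟨ rearrange e q (q ^ k) (q ∸ 1) ⟩
    q * (q ^ k * (q ∸ 1) * e)           ∎)
    where
      rearrange : ∀ e q K r → e * (q * K * r) ≡ q * (K * r * e)
      rearrange = solve 4 (λ e q K r → e :* (q :* K :* r) := q :* (K :* r :* e)) refl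

module FiniteFields {c} (F : FiniteField c) where

  open import Data.Nat as ℕ using (_≤_; z≤n; s≤s; NonZero)
  import Data.Nat.Properties as ℕP
  open import Data.Fin using (Fin; zero; suc)
  import Data.Fin.Properties as FinP
  open import Data.Product using (_,_)
  open import Data.Empty using (⊥-elim)
  open import Function using (_∘_)
  open import Function.Bundles using (Injection)
  open import Function.Properties.Inverse using (↔⇒↣)
  open import Relation.Binary.PropositionalEquality
  open import Algebra.Structures using (IsCommutativeRing)

  open FiniteField F renaming (_*_ to infixl 7 _*ᶠ_)
  open IsCommutativeRing isCommutativeRing using (zeroʳ; *-assoc; *-comm; *-identityˡ)

  2≤q : 2 ≤ q
  2≤q = FinP.injective⇒≤ {f = Injection.to (↔⇒↣ enum) ∘ bit}
          (bit-injective _ _ ∘ Injection.injective (↔⇒↣ enum))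
    where
      bit : Fin 2 → Carrier
      bit zero    = 0#
      bit (suc _) = 1#
      bit-injective : ∀ i j → bit i ≡ bit j → i ≡ j
      bit-injective zero       zero       _  = refl
      bit-injective zero       (suc zero) eq = ⊥-elim (0≢1 eq)
      bit-injective (suc zero) zero       eq = ⊥-elim (0≢1 (sym eq))
      bit-injective (suc zero) (suc zero) _  = refl

  instance
    q-nonZero : NonZero q
    q-nonZero = ℕ.>-nonZero (ℕP.≤-trans (s≤s z≤n) 2≤q)

  *-nonZero : ∀ {a b} → a ≢ 0# → b ≢ 0# → a *ᶠ b ≢ 0#
  *-nonZero {a} {b} a≢0 b≢0 ab≡0 with inverse a a≢0
  ... | a⁻¹ , aa⁻¹≡1 = b≢0 (begin
    b                ≡⟨ sym (*-identityˡ b) ⟩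
    1# *ᶠ b          ≡⟨ cong (_*ᶠ b) (trans (sym aa⁻¹≡1) (*-comm a a⁻¹)) ⟩
    (a⁻¹ *ᶠ a) *ᶠ b  ≡⟨ *-assoc a⁻¹ a b ⟩
    a⁻¹ *ᶠ (a *ᶠ b)  ≡⟨ cong (a⁻¹ *ᶠ_) ab≡0 ⟩
    a⁻¹ *ᶠ 0#        ≡⟨ zeroʳ a⁻¹ ⟩
    0#               ∎)
    where open ≡-Reasoning

module Polynomials {c} (F : FiniteField c) where

  open import Data.Nat using (ℕ; zero; suc; _+_; _*_; _∸_; _≤_; _<_; z≤n; s≤s)
  import Data.Nat.Properties as ℕP
  open import Data.List using ([]; _∷_; length)
  open import Data.Product using (_×_; _,_; proj₂)
  open import Data.Empty using (⊥-elim)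
  open import Function using (_∘_)
  open import Relation.Nullary using (¬_; yes; no)
  open import Relation.Binary.PropositionalEquality
  open import Algebra.Structures using (IsCommutativeRing)

  open FiniteField F renaming (_+_ to infixl 6 _+ᶠ_; _*_ to infixl 7 _*ᶠ_)
  open Drinfeld F
  open FiniteFields F using (*-nonZero)
  open IsCommutativeRing isCommutativeRing using (+-identityˡ; +-identityʳ; zeroˡ; zeroʳ)

  coeff : Poly → ℕ → Carrier
  coeff []      _       = 0#
  coeff (a ∷ p) zero    = a
  coeff (a ∷ p) (suc j) = coeff p j

  coeff-addP : ∀ p r j → coeff (addP p r) j ≡ coeff p j +ᶠ coeff r j
  coeff-addP []      r       j       = sym (+-identityˡ _)
  coeff-addP (a ∷ p) []      j       = sym (+-identityʳ _)
  coeff-addP (a ∷ p) (b ∷ r) zero    = refl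
  coeff-addP (a ∷ p) (b ∷ r) (suc j) = coeff-addP p r j

  coeff-scaleP : ∀ a p j → coeff (scaleP a p) j ≡ a *ᶠ coeff p j
  coeff-scaleP a []      j       = sym (zeroʳ a)
  coeff-scaleP a (b ∷ p) zero    = refl
  coeff-scaleP a (b ∷ p) (suc j) = coeff-scaleP a p j

  coeff-mulP-zero : ∀ a p r → coeff (mulP (a ∷ p) r) zero ≡ a *ᶠ coeff r zero
  coeff-mulP-zero a p r = begin
    coeff (mulP (a ∷ p) r) zero   ≡⟨ coeff-addP (scaleP a r) (0# ∷ mulP p r) zero ⟩
    coeff (scaleP a r) zero +ᶠ 0# ≡⟨ +-identityʳ _ ⟩
    coeff (scaleP a r) zero       ≡⟨ coeff-scaleP a r zero ⟩
    a *ᶠ coeff r zero             ∎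
    where open ≡-Reasoning

  coeff-mulP-suc : ∀ a p r j →
    coeff (mulP (a ∷ p) r) (suc j) ≡ a *ᶠ coeff r (suc j) +ᶠ coeff (mulP p r) j
  coeff-mulP-suc a p r j =
    trans (coeff-addP (scaleP a r) (0# ∷ mulP p r) (suc j))
          (cong (_+ᶠ coeff (mulP p r) j) (coeff-scaleP a r (suc j)))

  a*0+0≡0 : ∀ a → a *ᶠ 0# +ᶠ 0# ≡ 0#
  a*0+0≡0 a = trans (+-identityʳ _) (zeroʳ a)

  mulP-vanishes : ∀ p r → (∀ j → coeff p j ≡ 0#) → ∀ j → coeff (mulP p r) j ≡ 0#
  mulP-vanishes []      r p≡0 j       = refl
  mulP-vanishes (a ∷ p) r p≡0 zero    =
    trans (coeff-mulP-zero a p r) (trans (cong (_*ᶠ coeff r zero) (p≡0 zero)) (zeroˡ _))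
  mulP-vanishes (a ∷ p) r p≡0 (suc j) = begin
    coeff (mulP (a ∷ p) r) (suc j)              ≡⟨ coeff-mulP-suc a p r j ⟩
    a *ᶠ coeff r (suc j) +ᶠ coeff (mulP p r) j  ≡⟨ cong₂ _+ᶠ_ (cong (_*ᶠ coeff r (suc j)) (p≡0 zero))
                                                     (mulP-vanishes p r (p≡0 ∘ suc) j) ⟩
    0# *ᶠ coeff r (suc j) +ᶠ 0#                 ≡⟨ trans (+-identityʳ _) (zeroˡ _) ⟩
    0#                                          ∎
    where open ≡-Reasoning

  DegreeAtMost : Poly → ℕ → Set c
  DegreeAtMost p d = ∀ j → d < j → coeff p j ≡ 0#

  HasDegree : Poly → ℕ → Set c
  HasDegree p d = DegreeAtMost p d × coeff p d ≢ 0#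

  mulP-degreeAtMost : ∀ p r {a b} → DegreeAtMost p a → DegreeAtMost r b →
                      DegreeAtMost (mulP p r) (a + b)
  mulP-degreeAtMost []      r            p≤a r≤b j       _ = refl
  mulP-degreeAtMost (x ∷ p) r {zero}     p≤a r≤b (suc j) b<j = begin
    coeff (mulP (x ∷ p) r) (suc j)              ≡⟨ coeff-mulP-suc x p r j ⟩
    x *ᶠ coeff r (suc j) +ᶠ coeff (mulP p r) j  ≡⟨ cong₂ (λ u v → x *ᶠ u +ᶠ v) (r≤b (suc j) b<j)
                                                     (mulP-vanishes p r (λ i → p≤a (suc i) (s≤s z≤n)) j) ⟩
    x *ᶠ 0# +ᶠ 0#                               ≡⟨ a*0+0≡0 x ⟩
    0#                                          ∎
    where open ≡-Reasoning
  mulP-degreeAtMost (x ∷ p) r {suc a} {b} p≤a r≤b (suc j) (s≤s a+b<j) = begin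
    coeff (mulP (x ∷ p) r) (suc j)              ≡⟨ coeff-mulP-suc x p r j ⟩
    x *ᶠ coeff r (suc j) +ᶠ coeff (mulP p r) j  ≡⟨ cong₂ (λ u v → x *ᶠ u +ᶠ v)
                                                     (r≤b (suc j) (ℕP.<-trans (s≤s (ℕP.m≤n+m b a)) (s≤s a+b<j)))
                                                     (mulP-degreeAtMost p r (λ i → p≤a (suc i) ∘ s≤s) r≤b j a+b<j) ⟩
    x *ᶠ 0# +ᶠ 0#                               ≡⟨ a*0+0≡0 x ⟩
    0#                                          ∎
    where open ≡-Reasoning

  coeff-mulP-top : ∀ p r {a b} → DegreeAtMost p a → DegreeAtMost r b →
                   coeff (mulP p r) (a + b) ≡ coeff p a *ᶠ coeff r b
  coeff-mulP-top []      r p≤a r≤b = sym (zeroˡ _)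
  coeff-mulP-top (x ∷ p) r {zero} {zero}  p≤a r≤b = coeff-mulP-zero x p r
  coeff-mulP-top (x ∷ p) r {zero} {suc b} p≤a r≤b = begin
    coeff (mulP (x ∷ p) r) (suc b)              ≡⟨ coeff-mulP-suc x p r b ⟩
    x *ᶠ coeff r (suc b) +ᶠ coeff (mulP p r) b  ≡⟨ cong (x *ᶠ coeff r (suc b) +ᶠ_)
                                                     (mulP-vanishes p r (λ i → p≤a (suc i) (s≤s z≤n)) b) ⟩
    x *ᶠ coeff r (suc b) +ᶠ 0#                  ≡⟨ +-identityʳ _ ⟩
    x *ᶠ coeff r (suc b)                        ∎
    where open ≡-Reasoning
  coeff-mulP-top (x ∷ p) r {suc a} {b} p≤a r≤b = begin
    coeff (mulP (x ∷ p) r) (suc (a + b))              ≡⟨ coeff-mulP-suc x p r (a + b) ⟩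
    x *ᶠ coeff r (suc (a + b)) +ᶠ coeff (mulP p r) (a + b)
      ≡⟨ cong₂ (λ u v → x *ᶠ u +ᶠ v) (r≤b (suc (a + b)) (s≤s (ℕP.m≤n+m b a)))
               (coeff-mulP-top p r (λ i → p≤a (suc i) ∘ s≤s) r≤b) ⟩
    x *ᶠ 0# +ᶠ coeff p a *ᶠ coeff r b                  ≡⟨ cong (_+ᶠ coeff p a *ᶠ coeff r b) (zeroʳ x) ⟩
    0# +ᶠ coeff p a *ᶠ coeff r b                       ≡⟨ +-identityˡ _ ⟩
    coeff p a *ᶠ coeff r b                             ∎
    where open ≡-Reasoning

  mulP-hasDegree : ∀ p r {a b} → HasDegree p a → HasDegree r b → HasDegree (mulP p r) (a + b)
  mulP-hasDegree p r (p≤a , p-lead≢0) (r≤b , r-lead≢0) =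
    mulP-degreeAtMost p r p≤a r≤b ,
    λ eq → *-nonZero p-lead≢0 r-lead≢0 (trans (sym (coeff-mulP-top p r p≤a r≤b)) eq)

  powP-hasDegree : ∀ y {e} → HasDegree y e → ∀ n → HasDegree (powP y n) (n * e)
  powP-hasDegree y y≐e zero    = (λ { (suc j) _ → refl }) , 0≢1 ∘ sym
  powP-hasDegree y y≐e (suc n) = mulP-hasDegree y (powP y n) y≐e (powP-hasDegree y y≐e n)

  TP-degreeAtMost : DegreeAtMost TP 1
  TP-degreeAtMost (suc zero)    (s≤s ())
  TP-degreeAtMost (suc (suc j)) _ = refl

  addP-identityʳ : ∀ p → addP p [] ≡ p
  addP-identityʳ []      = refl
  addP-identityʳ (a ∷ p) = refl

  addP-hasDegreeʳ : ∀ p r {d D} → DegreeAtMost p d → d < D → HasDegree r D → HasDegree (addP p r) D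
  addP-hasDegreeʳ p r {D = D} p≤d d<D (r≤D , r-lead≢0) = addP≤D , addP-lead≢0
    where
      addP≤D : DegreeAtMost (addP p r) D
      addP≤D j D<j = begin
        coeff (addP p r) j       ≡⟨ coeff-addP p r j ⟩
        coeff p j +ᶠ coeff r j   ≡⟨ cong₂ _+ᶠ_ (p≤d j (ℕP.<-trans d<D D<j)) (r≤D j D<j) ⟩
        0# +ᶠ 0#                 ≡⟨ +-identityʳ 0# ⟩
        0#                       ∎
        where open ≡-Reasoning
      addP-lead≢0 : coeff (addP p r) D ≢ 0#
      addP-lead≢0 eq = r-lead≢0 (begin
        coeff r D                ≡⟨ sym (+-identityˡ _) ⟩
        0# +ᶠ coeff r D          ≡⟨ cong (_+ᶠ coeff r D) (sym (p≤d D d<D)) ⟩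
        coeff p D +ᶠ coeff r D   ≡⟨ sym (coeff-addP p r D) ⟩
        coeff (addP p r) D       ≡⟨ eq ⟩
        0#                       ∎)
        where open ≡-Reasoning

  coeff-strip : ∀ p j → coeff (strip p) j ≡ coeff p j
  coeff-strip []      j = refl
  coeff-strip (a ∷ p) j with strip p | coeff-strip p
  coeff-strip (a ∷ p) zero    | b ∷ s | _  = refl
  coeff-strip (a ∷ p) (suc j) | b ∷ s | ih = ih j
  coeff-strip (a ∷ p) j       | []    | ih with a ≟ 0#
  coeff-strip (a ∷ p) zero    | [] | _  | yes a≡0 = sym a≡0
  coeff-strip (a ∷ p) (suc j) | [] | ih | yes _   = ih j
  coeff-strip (a ∷ p) zero    | [] | _  | no _    = refl
  coeff-strip (a ∷ p) (suc j) | [] | ih | no _    = ih j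

  coeff-strip-last : ∀ p → ¬ IsZeroP p → coeff (strip p) (length (strip p) ∸ 1) ≢ 0#
  coeff-strip-last []      p≢0 = ⊥-elim (p≢0 refl)
  coeff-strip-last (a ∷ p) with strip p | coeff-strip-last p
  ... | b ∷ s | ih = λ _ → ih (λ ())
  ... | []    | _ with a ≟ 0#
  ...   | yes _   = λ a∷p≢0 → ⊥-elim (a∷p≢0 refl)
  ...   | no a≢0  = λ _ → a≢0

  coeff-beyond-length : ∀ p j → length p ≤ j → coeff p j ≡ 0#
  coeff-beyond-length []      j       _             = refl
  coeff-beyond-length (a ∷ p) (suc j) (s≤s len≤j)  = coeff-beyond-length p j len≤j

  deg-degreeAtMost : ∀ p → DegreeAtMost p (deg p)
  deg-degreeAtMost p j deg<j =
    trans (sym (coeff-strip p j)) (coeff-beyond-length (strip p) j (pred<⇒≤ (length (strip p)) deg<j))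
    where
      pred<⇒≤ : ∀ n → n ∸ 1 < j → n ≤ j
      pred<⇒≤ zero    _ = z≤n
      pred<⇒≤ (suc n) n<j = n<j

  deg-hasDegree : ∀ p → ¬ IsZeroP p → HasDegree p (deg p)
  deg-hasDegree p p≢0 = deg-degreeAtMost p ,
    λ eq → coeff-strip-last p p≢0 (trans (coeff-strip p (deg p)) eq)

  hasDegree⇒deg≡ : ∀ p {d} → HasDegree p d → deg p ≡ d
  hasDegree⇒deg≡ p {d} (p≤d , p-lead≢0) =
    ℕP.≤-antisym (ℕP.≮⇒≥ (λ d<deg → proj₂ (deg-hasDegree p p≢0) (p≤d (deg p) d<deg)))
                 (ℕP.≮⇒≥ (λ deg<d → p-lead≢0 (deg-degreeAtMost p d deg<d)))
    where
      p≢0 : ¬ IsZeroP p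
      p≢0 strip≡[] = p-lead≢0 (trans (sym (coeff-strip p d)) (cong (λ s → coeff s d) strip≡[]))

  degreeAtMost-mono : ∀ p {a b} → DegreeAtMost p a → a ≤ b → DegreeAtMost p b
  degreeAtMost-mono p p≤a a≤b j b<j = p≤a j (ℕP.≤-<-trans a≤b b<j)

  IsZeroP⇒deg≡0 : ∀ p → IsZeroP p → deg p ≡ 0
  IsZeroP⇒deg≡0 p strip≡[] = cong (λ s → length s ∸ 1) strip≡[]

module DegreeGrowth {c} (F : FiniteField c) where

  open import Data.Nat using (zero; suc; _+_; _*_; _^_; _∸_; _≤_; _<_; z<s; NonZero)
  open import Data.Nat.Properties
  open import Data.Vec using (Vec; []; _∷_; last; init)
  open import Data.Vec.Relation.Unary.All as All using (All; []; _∷_)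
  open import Data.Product using (proj₁)
  open import Relation.Nullary using (¬_)
  open import Relation.Binary.PropositionalEquality using (_≡_; refl; sym; trans; cong; subst)

  open FiniteField F using (q)
  open Drinfeld F
  open FiniteFields F using (q-nonZero)
  open Polynomials F
  open NatInequalities

  -- ds = (c_j, …, c_n): its last entry is the coefficient of y^(q^n).
  higherTerms-hasDegree : ∀ {a b e n m} j (ds : Vec Poly (suc m)) y → j + m ≡ n →
    All (λ d → DegreeAtMost d a) (init ds) → HasDegree (last ds) b → HasDegree y e →
    (∀ i → i < n → a + q ^ i * e < b + q ^ n * e) →
    HasDegree (higherTerms j ds y) (b + q ^ n * e)
  higherTerms-hasDegree {m = zero} j (d ∷ []) y refl [] d≐b y≐e _
    rewrite addP-identityʳ (mulP d (powP y (q ^ j))) | +-identityʳ j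
    = mulP-hasDegree d (powP y (q ^ j)) d≐b (powP-hasDegree y y≐e (q ^ j))
  higherTerms-hasDegree {m = suc m} j (d ∷ d′ ∷ ds) y refl (d≤a ∷ ds≤a) last≐b y≐e below =
    addP-hasDegreeʳ (mulP d (powP y (q ^ j))) (higherTerms (suc j) (d′ ∷ ds) y)
      (mulP-degreeAtMost d (powP y (q ^ j)) d≤a (proj₁ (powP-hasDegree y y≐e (q ^ j))))
      (below j (m<m+n j z<s))
      (higherTerms-hasDegree (suc j) (d′ ∷ ds) y (sym (+-suc j m)) ds≤a last≐b y≐e below)

  φT-hasDegree : ∀ {k a b e} (cs : Vec Poly (suc k)) y →
    All (λ d → DegreeAtMost d a) (init cs) → HasDegree (last cs) b → HasDegree y e → 1 ≤ a →
    (∀ i → i < suc k → a + q ^ i * e < b + q ^ suc k * e) →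
    HasDegree (φT cs y) (b + Θ (suc k) * e)
  φT-hasDegree {e = e} cs y cs≤a last≐b y≐e 1≤a below =
    addP-hasDegreeʳ (mulP TP y) (higherTerms 1 cs y)
      (mulP-degreeAtMost TP y TP-degreeAtMost (proj₁ y≐e))
      (≤-<-trans (+-mono-≤ 1≤a (≤-reflexive (sym (*-identityˡ e)))) (below 0 z<s))
      (higherTerms-hasDegree 1 cs y refl cs≤a last≐b y≐e below)

  φT-growth : ∀ {k} (cs : Vec Poly (suc k)) A → ¬ IsZeroP (last cs) →
    All (λ d → deg d ≤ deg (last cs) + A) (init cs) → 1 ≤ deg (last cs) + A →
    ∀ y → A < q ^ k * (q ∸ 1) * deg y → Θ (suc k) * deg y ≤ deg (φT cs y)
  φT-growth {k} cs A cᵣ≢0 cs≤ 1≤ y large =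
    subst (Θ (suc k) * deg y ≤_) (sym (hasDegree⇒deg≡ (φT cs y) φTy≐top)) (m≤n+m _ (deg (last cs)))
    where
      y≢0 : ¬ IsZeroP y
      y≢0 y≡0 = n≮0 (subst (A <_) (trans (cong (q ^ k * (q ∸ 1) *_) (IsZeroP⇒deg≡0 y y≡0))
                                          (*-zeroʳ (q ^ k * (q ∸ 1))))
                                   large)
      φTy≐top : HasDegree (φT cs y) (deg (last cs) + Θ (suc k) * deg y)
      φTy≐top = φT-hasDegree cs y
        (All.map (λ {d} → degreeAtMost-mono d (deg-degreeAtMost d)) cs≤)
        (deg-hasDegree (last cs) cᵣ≢0) (deg-hasDegree y y≢0) 1≤
        (λ i i<1+k → lower-terms-below-top q k A (deg (last cs)) (deg y) (≤-pred i<1+k) large)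

  φTⁿ-growth : ∀ {k} (cs : Vec Poly (suc k)) t .{{_ : NonZero t}} A C →
    (∀ y → A < C * deg y → t * deg y ≤ deg (φT cs y)) →
    ∀ x → A < C * deg x → ∀ n → t ^ n * deg x ≤ deg (φTⁿ cs n x)
  φTⁿ-growth cs t A C grow x large zero    = ≤-reflexive (*-identityˡ (deg x))
  φTⁿ-growth cs t A C grow x large (suc n) = begin
    t ^ suc n * deg x        ≡⟨ *-assoc t (t ^ n) (deg x) ⟩
    t * (t ^ n * deg x)      ≤⟨ *-monoʳ-≤ t tⁿx≤ ⟩
    t * deg (φTⁿ cs n x)     ≤⟨ grow (φTⁿ cs n x) (<-≤-trans large (*-monoʳ-≤ C x≤)) ⟩
    deg (φTⁿ cs (suc n) x)   ∎
    where
      open ≤-Reasoning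
      tⁿx≤ : t ^ n * deg x ≤ deg (φTⁿ cs n x)
      tⁿx≤ = φTⁿ-growth cs t A C grow x large n
      x≤ : deg x ≤ deg (φTⁿ cs n x)
      x≤ = ≤-trans (m≤n*m (deg x) (t ^ n) {{m^n≢0 t n}}) tⁿx≤

module MaxTerm {c} (F : FiniteField c) where

  open import Data.Nat as ℕ using (ℕ; suc)
  open import Data.Integer using (+_; -_; _+_; _-_; _≤_; _⊔_; ∣_∣; 0ℤ)
  open import Data.Integer.Properties
  open import Data.List using ([]; _∷_; foldr)
  open import Data.Vec using (Vec; []; _∷_; last; init)
  open import Data.Vec.Relation.Unary.All as All using (All; []; _∷_)
  open import Relation.Binary.PropositionalEquality using (_≡_; sym; cong; subst)

  open Drinfeld F
  open Polynomials F using (IsZeroP⇒deg≡0)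

  ⊔-fold-nonNeg : ∀ l → + 0 ≤ foldr _⊔_ (+ 0) l
  ⊔-fold-nonNeg []      = ≤-refl
  ⊔-fold-nonNeg (i ∷ l) = ≤-trans (⊔-fold-nonNeg l) (i≤j⊔i i _)

  degDiffs-bounded : ∀ b {m} (ds : Vec Poly m) →
    All (λ d → + deg d - + b ≤ foldr _⊔_ (+ 0) (degDiffs b ds)) ds
  degDiffs-bounded b []       = []
  degDiffs-bounded b (d ∷ ds) with strip d in d≡0 | degDiffs-bounded b ds
  ... | []    | ih = subst (λ n → + n - + b ≤ foldr _⊔_ (+ 0) (degDiffs b ds))
                       (sym (IsZeroP⇒deg≡0 d d≡0))
                       (≤-trans (i-j≤i (+ 0) (+ b)) (⊔-fold-nonNeg (degDiffs b ds))) ∷ ih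
  ... | _ ∷ _ | ih = i≤i⊔j _ _ ∷ All.map (λ le → ≤-trans le (i≤j⊔i _ _)) ih

  maxTerm-nonNeg : ∀ {k} (cs : Vec Poly (suc k)) → + 0 ≤ maxTerm cs
  maxTerm-nonNeg cs = ≤-trans (⊔-fold-nonNeg (degDiffs (deg (last cs)) (init cs))) (i≤j⊔i _ _)

  maxTermℕ : ∀ {k} → Vec Poly (suc k) → ℕ
  maxTermℕ cs = ∣ maxTerm cs ∣

  +maxTermℕ≡maxTerm : ∀ {k} (cs : Vec Poly (suc k)) → + maxTermℕ cs ≡ maxTerm cs
  +maxTermℕ≡maxTerm cs = 0≤i⇒+∣i∣≡i (maxTerm-nonNeg cs)

  ≤-from-difference : ∀ a b A → + a - + b ≤ + A → a ℕ.≤ b ℕ.+ A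
  ≤-from-difference a b A a-b≤A = drop‿+≤+ (begin
    + a                     ≡⟨ sym (+-identityʳ (+ a)) ⟩
    + a + 0ℤ                ≡⟨ cong (_+_ (+ a)) (sym (+-inverseˡ (+ b))) ⟩
    + a + (- + b + + b)     ≡⟨ sym (+-assoc (+ a) (- + b) (+ b)) ⟩
    + a - + b + + b         ≤⟨ +-monoˡ-≤ (+ b) a-b≤A ⟩
    + A + + b               ≡⟨ +-comm (+ A) (+ b) ⟩
    + b + + A               ≡⟨ sym (pos-+ b A) ⟩
    + (b ℕ.+ A)             ∎)
    where open ≤-Reasoning

  below-maxTerm : ∀ {k} (cs : Vec Poly (suc k)) a →
    + a - + deg (last cs) ≤ maxTerm cs → a ℕ.≤ deg (last cs) ℕ.+ maxTermℕ cs
  below-maxTerm cs a le =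
    ≤-from-difference a (deg (last cs)) (maxTermℕ cs)
      (subst (+ a - + deg (last cs) ≤_) (sym (+maxTermℕ≡maxTerm cs)) le)

  one-below-maxTerm : ∀ {k} (cs : Vec Poly (suc k)) → 1 ℕ.≤ deg (last cs) ℕ.+ maxTermℕ cs
  one-below-maxTerm cs = below-maxTerm cs 1 (i≤i⊔j _ _)

  degs-below-maxTerm : ∀ {k} (cs : Vec Poly (suc k)) →
    All (λ d → deg d ℕ.≤ deg (last cs) ℕ.+ maxTermℕ cs) (init cs)
  degs-below-maxTerm cs =
    All.map (λ {d} le → below-maxTerm cs (deg d) (≤-trans le (i≤j⊔i _ _)))
            (degDiffs-bounded (deg (last cs)) (init cs))

module RationalInequalities where

  open import Data.Nat as ℕ using (suc; NonZero)
  open import Data.Integer as ℤ using (+_)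
  import Data.Integer.Properties as ℤP
  open import Data.Rational.Unnormalised using (0ℚᵘ; _/_; _-_; _≤_; *≤*)
  open import Data.Rational.Unnormalised.Properties using (+-monoʳ-≤; neg-mono-≤; +-identityʳ-≡)
  open import Relation.Binary.PropositionalEquality using (subst; subst₂)

  fraction-≤ : ∀ a b m n .{{_ : NonZero m}} .{{_ : NonZero n}} →
    a ℕ.* n ℕ.≤ b ℕ.* m → + a / m ≤ + b / n
  fraction-≤ a b (suc m) (suc n) an≤bm =
    *≤* (subst₂ ℤ._≤_ (ℤP.pos-* a (suc n)) (ℤP.pos-* b (suc m)) (ℤ.+≤+ an≤bm))

  p-q≤p : ∀ p {q} → 0ℚᵘ ≤ q → p - q ≤ p
  p-q≤p p {q} 0≤q = subst (p - q ≤_) (+-identityʳ-≡ p) (+-monoʳ-≤ p (neg-mono-≤ 0≤q))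

module HeightDifference {c} (F : FiniteField c) where

  open import Data.Nat as ℕ using (ℕ; suc; _^_; _∸_; z≤n; s≤s; NonZero)
  import Data.Nat.Properties as ℕP
  open import Data.Integer as ℤ using (+_)
  import Data.Integer.Properties as ℤP
  open import Data.Rational.Unnormalised using (0ℚᵘ; _/_; _-_; _≤_)
  open import Data.Rational.Unnormalised.Properties using (≤-trans; p≤q⇒p-q≤0)
  open import Data.Vec using (Vec; last)
  open import Relation.Nullary using (¬_; yes; no)
  open import Relation.Binary.PropositionalEquality using (_≡_; sym; cong; subst; subst₂)

  open FiniteField F using (q)
  open Drinfeld F
  open FiniteFields F using (2≤q; q-nonZero)
  open DegreeGrowth F using (φT-growth; φTⁿ-growth)
  open MaxTerm F
  open NatInequalities using (above-threshold)
  open RationalInequalities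

  Θ-nonZero : ∀ r → NonZero (Θ r)
  Θ-nonZero r = ℕP.m^n≢0 q r

  Θⁿ-nonZero : ∀ r n → NonZero (Θ r ^ n)
  Θⁿ-nonZero r n = ℕP.m^n≢0 (Θ r) n {{Θ-nonZero r}}

  denominator : ℕ → ℕ
  denominator k = (Θ (suc k) ∸ 1) ℕ.* (q ∸ 1)

  denominator-nonZero : ∀ k → NonZero (denominator k)
  denominator-nonZero k = ℕP.m*n≢0 _ _ {{pred-nonZero 2≤Θ}} {{pred-nonZero 2≤q}}
    where
      pred-nonZero : ∀ {n} → 2 ℕ.≤ n → NonZero (n ∸ 1)
      pred-nonZero (s≤s (s≤s _)) = _
      2≤Θ : 2 ℕ.≤ Θ (suc k)
      2≤Θ = ℕP.≤-trans 2≤q (ℕP.m≤m*n q (q ^ k) {{ℕP.m^n≢0 q k}})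

  Mφ≡ : ∀ {k} (cs : Vec Poly (suc k)) →
    Mφ cs ≡ (+ (q ℕ.* maxTermℕ cs) / denominator k) {{denominator-nonZero k}}
  Mφ≡ {k} cs = cong (λ i → (i / denominator k) {{denominator-nonZero k}})
    (subst (λ j → + q ℤ.* j ≡ + (q ℕ.* maxTermℕ cs)) (+maxTermℕ≡maxTerm cs)
           (sym (ℤP.pos-* q (maxTermℕ cs))))

  Mφ-nonNeg : ∀ {k} (cs : Vec Poly (suc k)) → 0ℚᵘ ≤ Mφ cs
  Mφ-nonNeg {k} cs = subst (0ℚᵘ ≤_) (sym (Mφ≡ cs))
    (fraction-≤ 0 _ 1 (denominator k) {{_}} {{denominator-nonZero k}} z≤n)

  ĥApprox-nonNeg : ∀ {k} (cs : Vec Poly (suc k)) x n → 0ℚᵘ ≤ ĥApprox cs x n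
  ĥApprox-nonNeg {k} cs x n = fraction-≤ 0 _ 1 (Θ (suc k) ^ n) {{_}} {{Θⁿ-nonZero (suc k) n}} z≤n

  h-ĥApprox≤Mφ : ∀ k (cs : Vec Poly (suc k)) → ¬ IsZeroP (last cs) → ∀ x n →
    (+ h x) / 1 - ĥApprox cs x n ≤ Mφ cs
  h-ĥApprox≤Mφ k cs cᵣ≢0 x n with h x ℕ.* denominator k ℕP.≤? q ℕ.* maxTermℕ cs
  ... | yes small = ≤-trans (p-q≤p _ (ĥApprox-nonNeg cs x n)) h≤Mφ
    where
      h≤Mφ : (+ h x) / 1 ≤ Mφ cs
      h≤Mφ = subst ((+ h x) / 1 ≤_) (sym (Mφ≡ cs))
        (fraction-≤ (h x) _ 1 (denominator k) {{_}} {{denominator-nonZero k}}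
          (subst (h x ℕ.* denominator k ℕ.≤_) (sym (ℕP.*-identityʳ _)) small))
  ... | no large = ≤-trans (p≤q⇒p-q≤0 h≤ĥApprox) (Mφ-nonNeg cs)
    where
      growth : Θ (suc k) ^ n ℕ.* h x ℕ.≤ h (φTⁿ cs n x)
      growth = φTⁿ-growth cs (Θ (suc k)) {{Θ-nonZero (suc k)}} (maxTermℕ cs) (q ^ k ℕ.* (q ∸ 1))
        (φT-growth cs (maxTermℕ cs) cᵣ≢0 (degs-below-maxTerm cs) (one-below-maxTerm cs))
        x (above-threshold q k (maxTermℕ cs) (h x) (ℕP.≰⇒> large)) n
      h≤ĥApprox : (+ h x) / 1 ≤ ĥApprox cs x n
      h≤ĥApprox = fraction-≤ (h x) _ 1 (Θ (suc k) ^ n) {{_}} {{Θⁿ-nonZero (suc k) n}}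
        (subst₂ ℕ._≤_ (ℕP.*-comm _ (h x)) (sym (ℕP.*-identityʳ _)) growth)

open import Data.Nat using (ℕ; suc; _≤_)
open import Data.Vec using (Vec; last)
open import Data.Product using (∃; _,_)
open import Data.Integer using (+_)
open import Data.Rational.Unnormalised using (ℚᵘ; 0ℚᵘ; _/_; _+_; _-_; _<_) renaming (_≤_ to _≤ℚ_)
open import Data.Rational.Unnormalised.Properties using (≤-trans; <⇒≤; p≤p+q)
open import Data.Rational.Unnormalised.Base using (nonNegative)
open import Relation.Nullary using (¬_)

lemma2p8 : ∀ {c} (F : FiniteField c) → let open Drinfeld F in
  (k : ℕ) (cs : Vec Poly (suc k)) → ¬ IsZeroP (last cs) →
  (x : Poly) → (ε : ℚᵘ) → 0ℚᵘ < ε →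
  ∃ λ N → ∀ n → N ≤ n →
    ((+ h x) / 1) - ĥApprox cs x n ≤ℚ Mφ cs + ε
lemma2p8 F k cs cᵣ≢0 x ε 0<ε = 0 , λ n _ →
  ≤-trans (HeightDifference.h-ĥApprox≤Mφ F k cs cᵣ≢0 x n)
          (p≤p+q (Drinfeld.Mφ F cs) ε {{nonNegative (<⇒≤ 0<ε)}})
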